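{- Let $\alpha,\alpha'\in\Omega$ be conjugate in $\Omega$. Then $s_n(\alpha)=s_n(\alpha')$ for all $n\ge1$. Hence $\alpha$ is settled (resp. strongly settled) if and only if $\alpha'$ is settled (resp. strongly settled).
   Context: $T$ is the rooted binary tree of finite words over $\{0,1\}$ (level $n$ = words of length $n$), $\Omega=\mathrm{Aut}(T)$. A vertex $v$ at level $n$ lies in a stable cycle of $\alpha$ of length $k$ if its $\alpha$-orbit has $k$ elements and for every $m>n$ the vertices at level $m$ above this orbit form a single $\alpha$-cycle of length $2^{m-n}k$. $s_n(\alpha)$ is the number of vertices at level $n$ lying in a stable cycle of $\alpha$. $\alpha$ is settled if $s_n(\alpha)/2^n\to1$, and strongly settled if for some $n$ every vertex at level $n$ lies in a stable cycle of $\alpha$. -}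

module Defs where

open import Data.Bool using (Bool)
open import Data.Nat using (ℕ; zero; suc; _^_; _*_; _∸_; _<_; _≤_)
open import Data.Vec using (Vec; _∷_; _++_; tail)
open import Data.List using (List; length)
open import Data.List.Membership.Propositional using (_∈_)
open import Data.List.Relation.Unary.Unique.Propositional using (Unique)
open import Data.Product using (Σ; ∃; _×_)
open import Data.Sum using (_⊎_)
open import Function.Bundles using (_⇔_)
open import Relation.Binary.PropositionalEquality using (_≡_)

-- Vertices of level n of the binary rooted tree T.
-- Encoding: a word w = x₁ x₂ … xₙ is stored REVERSED, i.e. as the vector
-- xₙ ∷ … ∷ x₁ ∷ [].  Thus the children of v are  b ∷ v  (= v b), the parent
-- of  b ∷ v  is v, and the descendants of v at level j+n are  u ++ v.
Word : ℕ → Set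
Word n = Vec Bool n

-- Automorphisms of T: level-preserving bijections on vertices commuting
-- with the parent map (equivalently, preserving adjacency and the root).
record Aut : Set where
  field
    fun     : ∀ {n} → Word n → Word n
    inv     : ∀ {n} → Word n → Word n
    parent  : ∀ {n} (b : Bool) (v : Word n) → tail (fun (b ∷ v)) ≡ fun v
    inv-fun : ∀ {n} (v : Word n) → inv (fun v) ≡ v
    fun-inv : ∀ {n} (v : Word n) → fun (inv v) ≡ v
open Aut public

iter : Aut → ℕ → ∀ {n} → Word n → Word n
iter α zero    v = v
iter α (suc i) v = fun α (iter α i v)

iterInv : Aut → ℕ → ∀ {n} → Word n → Word n
iterInv α zero    v = v
iterInv α (suc i) v = inv α (iterInv α i v)

Conjugate : Aut → Aut → Set
Conjugate α α' = Σ Aut λ γ → ∀ {n} (v : Word n) → fun α' v ≡ fun γ (fun α (inv γ v))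

InOrbit : Aut → ∀ {n} → Word n → Word n → Set
InOrbit α v w = ∃ λ i → (iter α i v ≡ w) ⊎ (iterInv α i v ≡ w)

OrbitSize : Aut → ∀ {n} → Word n → ℕ → Set
OrbitSize α {n} v k =
  Σ (List (Word n)) λ L → Unique L × (∀ w → (w ∈ L) ⇔ InOrbit α v w) × (length L ≡ k)

AboveOrbit : Aut → ∀ {n} → Word n → ∀ {j} → Word (j Data.Nat.+ n) → Set
AboveOrbit α {n} v {j} x = ∃ λ (u : Word j) → ∃ λ (v' : Word n) → InOrbit α v v' × (x ≡ u ++ v')

Stable : Aut → ∀ {n} → Word n → Set
Stable α {n} v = Σ ℕ λ k → OrbitSize α v k ×
  (∀ (j : ℕ) (u : Word (suc j)) (v' : Word n) → InOrbit α v v' →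
     OrbitSize α (u ++ v') (2 ^ suc j * k) ×
     (∀ (x : Word (suc j Data.Nat.+ n)) → InOrbit α (u ++ v') x ⇔ AboveOrbit α v x))

HasStableCount : Aut → ℕ → ℕ → Set
HasStableCount α n c =
  Σ (List (Word n)) λ L → Unique L × (∀ v → (v ∈ L) ⇔ Stable α v) × (length L ≡ c)

-- settled: s_n(α)/2^n → 1, i.e. for every r there is N such that for all
-- n ≥ N,  1 - s_n/2^n < 1/(r+1),  i.e.  (2^n - s_n)(r+1) < 2^n.
Settled : Aut → Set
Settled α = ∀ (r : ℕ) → ∃ λ N → ∀ n → N ≤ n →
  ∃ λ c → HasStableCount α n c × ((2 ^ n ∸ c) * suc r < 2 ^ n)

StronglySettled : Aut → Set
StronglySettled α = ∃ λ n → ∀ (v : Word n) → Stable α v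

-- If α' = γ α γ⁻¹, then γ maps α-orbits onto α'-orbits of the same size
-- and, since it commutes with taking ancestors, maps the vertices above an
-- α-orbit onto the vertices above its image.  So γ maps the stable cycles
-- of α bijectively onto those of α', level by level, and everything
-- defined from the stable counts is conjugation invariant.
module Submission where

open import Defs
open import Data.Nat using (ℕ; _≤_; suc; _+_; _^_; _*_)
open import Data.Product using (_×_; _,_; Σ; ∃)
open import Data.Sum using (inj₁; inj₂)
open import Data.Bool using (Bool)
open import Data.Vec using (_∷_; _++_; tail; take; drop)
open import Data.Vec.Properties using (take++drop≡id; ++-injectiveʳ)
open import Data.List using (List; map; length)
open import Data.List.Membership.Propositional using (_∈_)
open import Data.List.Membership.Propositional.Properties using (∈-map⁺; ∈-map⁻)
open import Data.List.Relation.Unary.Unique.Propositional using (Unique)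
open import Data.List.Relation.Unary.Unique.Propositional.Properties using (map⁺)
open import Data.List.Properties using (length-map)
open import Function.Bundles using (_⇔_; mk⇔; Equivalence)
open import Function.Construct.Composition using (_⇔-∘_)
open import Function.Construct.Symmetry using (⇔-sym)
open import Relation.Binary.PropositionalEquality

open Equivalence using (to; from)

-- OrbitSize α v k unfolds to Counted (InOrbit α v) k, and
-- HasStableCount α n c to Counted (Stable α) c.
Counted : {A : Set} → (A → Set) → ℕ → Set
Counted {A} P k = Σ (List A) λ L → Unique L × (∀ x → (x ∈ L) ⇔ P x) × (length L ≡ k)

_⁻¹ : Aut → Aut
γ ⁻¹ = record
  { fun     = inv γ
  ; inv     = fun γ
  ; parent  = inv-parent
  ; inv-fun = fun-inv γ
  ; fun-inv = inv-fun γ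
  }
  where
  inv-parent : ∀ {n} (b : Bool) (v : Word n) → tail (inv γ (b ∷ v)) ≡ inv γ v
  inv-parent b v with inv γ (b ∷ v) | fun-inv γ (b ∷ v)
  ... | c ∷ w | γw≡bv = begin
    w                             ≡⟨ inv-fun γ w ⟨
    inv γ (fun γ w)               ≡⟨ cong (inv γ) (parent γ c w) ⟨
    inv γ (tail (fun γ (c ∷ w)))  ≡⟨ cong (λ x → inv γ (tail x)) γw≡bv ⟩
    inv γ v                       ∎
    where open ≡-Reasoning

fun-injective : (γ : Aut) → ∀ {n} {x y : Word n} → fun γ x ≡ fun γ y → x ≡ y
fun-injective γ {x = x} {y} γx≡γy =
  trans (sym (inv-fun γ x)) (trans (cong (inv γ) γx≡γy) (inv-fun γ y))

counted-map : {n k : ℕ} {P Q : Word n → Set} (γ : Aut) →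
              (∀ y → Q y ⇔ P (inv γ y)) → Counted P k → Counted Q k
counted-map {P = P} {Q} γ Q⇔P (L , unique , members , length≡k) =
  map (fun γ) L , map⁺ (fun-injective γ) unique , members′ ,
  trans (length-map (fun γ) L) length≡k
  where
  members′ : ∀ y → (y ∈ map (fun γ) L) ⇔ Q y
  members′ y = mk⇔
    (λ y∈ → let x , x∈L , y≡γx = ∈-map⁻ (fun γ) y∈ in
      subst Q (sym y≡γx)
        (from (Q⇔P (fun γ x)) (subst P (sym (inv-fun γ x)) (to (members x) x∈L))))
    (λ Qy → subst (_∈ map (fun γ) L) (fun-inv γ y)
      (∈-map⁺ (fun γ) (from (members (inv γ y)) (to (Q⇔P y) Qy))))

transport-⇔ : {n : ℕ} {P Q : Word n → Set} (γ : Aut) →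
              (∀ {x} → P x → Q (fun γ x)) → (∀ {y} → Q y → P (inv γ y)) →
              ∀ y → Q y ⇔ P (inv γ y)
transport-⇔ {Q = Q} γ P⇒Q Q⇒P y = mk⇔ Q⇒P (λ p → subst Q (fun-inv γ y) (P⇒Q p))

drop-suc : ∀ j {n} (x : Word (suc j + n)) → drop (suc j) x ≡ drop j (tail x)
drop-suc j (b ∷ x) = refl

drop-fun : (γ : Aut) → ∀ j {n} (x : Word (j + n)) → drop j (fun γ x) ≡ fun γ (drop j x)
drop-fun γ 0       x       = refl
drop-fun γ (suc j) (b ∷ x) = begin
  drop (suc j) (fun γ (b ∷ x))  ≡⟨ drop-suc j (fun γ (b ∷ x)) ⟩
  drop j (tail (fun γ (b ∷ x))) ≡⟨ cong (drop j) (parent γ b x) ⟩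
  drop j (fun γ x)              ≡⟨ drop-fun γ j x ⟩
  fun γ (drop j x)              ∎
  where open ≡-Reasoning

drop-++ : ∀ {j n} (u : Word j) (v : Word n) → drop j (u ++ v) ≡ v
drop-++ {j} u v = sym (++-injectiveʳ u (take j (u ++ v)) (sym (take++drop≡id j (u ++ v))))

fun-++ : (γ : Aut) → ∀ {j n} (u : Word j) (v : Word n) →
         ∃ λ (u′ : Word j) → fun γ (u ++ v) ≡ u′ ++ fun γ v
fun-++ γ {j} u v = u′ , (begin
  fun γ (u ++ v)                   ≡⟨ take++drop≡id j (fun γ (u ++ v)) ⟨
  u′ ++ drop j (fun γ (u ++ v))    ≡⟨ cong (u′ ++_) (drop-fun γ j (u ++ v)) ⟩
  u′ ++ fun γ (drop j (u ++ v))    ≡⟨ cong (λ w → u′ ++ fun γ w) (drop-++ u v) ⟩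
  u′ ++ fun γ v                    ∎)
  where
  open ≡-Reasoning
  u′ : Word j
  u′ = take j (fun γ (u ++ v))

record Intertwines (γ α α′ : Aut) : Set where
  constructor intertwines
  field commutes : ∀ {n} (v : Word n) → fun α′ (fun γ v) ≡ fun γ (fun α v)
open Intertwines

conjugate⇒intertwines : ∀ {α α′} ((γ , _) : Conjugate α α′) → Intertwines γ α α′
conjugate⇒intertwines {α} (γ , α′≡γαγ⁻¹) = intertwines λ v →
  trans (α′≡γαγ⁻¹ (fun γ v)) (cong (λ w → fun γ (fun α w)) (inv-fun γ v))

intertwines-⁻¹ : ∀ {γ α α′} → Intertwines γ α α′ → Intertwines (γ ⁻¹) α′ α
intertwines-⁻¹ {γ} {α} {α′} comm = intertwines λ v → fun-injective γ (begin
  fun γ (fun α (inv γ v))   ≡⟨ commutes comm (inv γ v) ⟨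
  fun α′ (fun γ (inv γ v))  ≡⟨ cong (fun α′) (fun-inv γ v) ⟩
  fun α′ v                  ≡⟨ fun-inv γ (fun α′ v) ⟨
  fun γ (inv γ (fun α′ v))  ∎)
  where open ≡-Reasoning

module Intertwining {γ α α′ : Aut} (comm : Intertwines γ α α′) where

  inv-comm : ∀ {n} (v : Word n) → inv α′ (fun γ v) ≡ fun γ (inv α v)
  inv-comm v = fun-injective α′ (begin
    fun α′ (inv α′ (fun γ v))  ≡⟨ fun-inv α′ (fun γ v) ⟩
    fun γ v                    ≡⟨ cong (fun γ) (fun-inv α v) ⟨
    fun γ (fun α (inv α v))    ≡⟨ commutes comm (inv α v) ⟨
    fun α′ (fun γ (inv α v))   ∎)
    where open ≡-Reasoning

  iter-comm : ∀ i {n} (v : Word n) → iter α′ i (fun γ v) ≡ fun γ (iter α i v)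
  iter-comm 0       v = refl
  iter-comm (suc i) v = trans (cong (fun α′) (iter-comm i v)) (commutes comm (iter α i v))

  iterInv-comm : ∀ i {n} (v : Word n) → iterInv α′ i (fun γ v) ≡ fun γ (iterInv α i v)
  iterInv-comm 0       v = refl
  iterInv-comm (suc i) v = trans (cong (inv α′) (iterInv-comm i v)) (inv-comm (iterInv α i v))

  inOrbit-map : ∀ {n} {v w : Word n} → InOrbit α v w → InOrbit α′ (fun γ v) (fun γ w)
  inOrbit-map (i , inj₁ αⁱv≡w) = i , inj₁ (trans (iter-comm i _) (cong (fun γ) αⁱv≡w))
  inOrbit-map (i , inj₂ α⁻ⁱv≡w) = i , inj₂ (trans (iterInv-comm i _) (cong (fun γ) α⁻ⁱv≡w))

  aboveOrbit-map : ∀ {n j} {v : Word n} {x : Word (j + n)} →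
                   AboveOrbit α v x → AboveOrbit α′ (fun γ v) (fun γ x)
  aboveOrbit-map (u , v′ , v~v′ , refl) =
    let u′ , γuv′≡u′γv′ = fun-++ γ u v′ in u′ , fun γ v′ , inOrbit-map v~v′ , γuv′≡u′γv′

-- The condition that Stable α v imposes on a vertex z at level suc j + n
-- over the orbit of v.
SingleCycleAbove : Aut → ∀ {n} → Word n → ℕ → ∀ {j} → Word (suc j + n) → Set
SingleCycleAbove α v k {j} z =
  OrbitSize α z (2 ^ suc j * k) × (∀ x → InOrbit α z x ⇔ AboveOrbit α v x)

module Conjugacy {γ α α′ : Aut} (comm : Intertwines γ α α′) where

  private
    module F = Intertwining comm
    module B = Intertwining (intertwines-⁻¹ comm)

  inOrbit-⇔ : ∀ {n} (v : Word n) y → InOrbit α′ (fun γ v) y ⇔ InOrbit α v (inv γ y)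
  inOrbit-⇔ v = transport-⇔ γ F.inOrbit-map
    (λ v~y → subst (λ v′ → InOrbit α v′ _) (inv-fun γ v) (B.inOrbit-map v~y))

  aboveOrbit-⇔ : ∀ {n j} (v : Word n) (y : Word (j + n)) →
                 AboveOrbit α′ (fun γ v) y ⇔ AboveOrbit α v (inv γ y)
  aboveOrbit-⇔ v = transport-⇔ γ F.aboveOrbit-map
    (λ above → subst (λ v′ → AboveOrbit α v′ _) (inv-fun γ v) (B.aboveOrbit-map above))

  orbitSize-map : ∀ {n} {v : Word n} {k} → OrbitSize α v k → OrbitSize α′ (fun γ v) k
  orbitSize-map {v = v} = counted-map γ (inOrbit-⇔ v)

  singleCycleAbove-map : ∀ {n j} {v : Word n} {k} {z : Word (suc j + n)} →
    SingleCycleAbove α v k z → SingleCycleAbove α′ (fun γ v) k (fun γ z)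
  singleCycleAbove-map {v = v} {z = z} (size , cycle⇔above) =
    orbitSize-map size ,
    λ y → ⇔-sym (aboveOrbit-⇔ v y) ⇔-∘ (cycle⇔above (inv γ y) ⇔-∘ inOrbit-⇔ z y)

  stable-map : ∀ {n} {v : Word n} → Stable α v → Stable α′ (fun γ v)
  stable-map {v = v} (k , size , cycles) = k , orbitSize-map size , λ j u v′ γv~v′ →
    let u₀ , γ⁻¹uv′≡u₀γ⁻¹v′ = fun-++ (γ ⁻¹) u v′
        γu₀γ⁻¹v′≡uv′ = trans (cong (fun γ) (sym γ⁻¹uv′≡u₀γ⁻¹v′)) (fun-inv γ (u ++ v′))
    in subst (SingleCycleAbove α′ (fun γ v) k) γu₀γ⁻¹v′≡uv′
         (singleCycleAbove-map (cycles j u₀ (inv γ v′) (to (inOrbit-⇔ v v′) γv~v′)))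

module StableCount {γ α α′ : Aut} (comm : Intertwines γ α α′) where

  stable-⇔ : ∀ {n} (y : Word n) → Stable α′ y ⇔ Stable α (inv γ y)
  stable-⇔ = transport-⇔ γ (Conjugacy.stable-map comm)
                           (Conjugacy.stable-map (intertwines-⁻¹ comm))

  hasStableCount-map : ∀ n c → HasStableCount α n c → HasStableCount α′ n c
  hasStableCount-map n c = counted-map γ stable-⇔

  stronglySettled-map : StronglySettled α → StronglySettled α′
  stronglySettled-map (n , allStable) = n , λ y → from (stable-⇔ y) (allStable (inv γ y))

settled-map : ∀ {α α′} → (∀ n c → HasStableCount α n c → HasStableCount α′ n c) →
              Settled α → Settled α′
settled-map count-map settled r =
  let N , close = settled r
  in N , λ n N≤n → let c , count , bound = close n N≤n in c , count-map n c count , bound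

proposition3p3 : (α α' : Aut) → Conjugate α α' →
    ((n : ℕ) → 1 ≤ n → (c : ℕ) → HasStableCount α n c ⇔ HasStableCount α' n c)
    × (Settled α ⇔ Settled α')
    × (StronglySettled α ⇔ StronglySettled α')
proposition3p3 α α' conj@(γ , _) =
  (λ n _ c → mk⇔ (F.hasStableCount-map n c) (B.hasStableCount-map n c)) ,
  mk⇔ (settled-map F.hasStableCount-map) (settled-map B.hasStableCount-map) ,
  mk⇔ F.stronglySettled-map B.stronglySettled-map
  where
  comm : Intertwines γ α α'
  comm = conjugate⇒intertwines conj
  module F = StableCount comm
  module B = StableCount (intertwines-⁻¹ comm)
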